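{- Let $G$ be a global type and $\mathcal M\equiv_G\mathcal M'$. (1) If $\mathrm{read}(G,\mathcal M)$, then $\mathrm{read}(G,\mathcal M')$. (2) For every finite set $\mathcal S$ of global types, if $\mathcal S\vdash_{\mathrm{dread}}G:\mathcal M$, then $\mathcal S\vdash_{\mathrm{dread}}G:\mathcal M'$.
   Context: Participants $\mathsf p,\mathsf q,\mathsf r,\mathsf s$; labels $\lambda$. A message is $\langle\mathsf p,\lambda,\mathsf q\rangle$; a queue $\mathcal M$ is a finite sequence of messages ($\emptyset$, $\cdot$), modulo the congruence $\equiv$ generated by $\langle\mathsf p,\lambda,\mathsf q\rangle\cdot\langle\mathsf r,\lambda',\mathsf s\rangle\equiv\langle\mathsf r,\lambda',\mathsf s\rangle\cdot\langle\mathsf p,\lambda,\mathsf q\rangle$ when $\mathsf p\neq\mathsf r$ or $\mathsf q\neq\mathsf s$. Global types are possibly infinite regular terms $G ::= \mathsf{End}\mid \mathsf p\mathsf q!\{\lambda_i;G_i\}_{i\in I}\mid\mathsf p\mathsf q?\{\lambda_i;G_i\}_{i\in I}$ ($I$ finite nonempty, $\mathsf p\neq\mathsf q$, $\lambda_i$ distinct); a global type occurs in $G$ if it is a subterm of $G$. Readability $\mathrm{read}(G,\mathcal M)$ (inductive): $\mathrm{read}(G,\emptyset)$; $\mathrm{read}(\mathsf p\mathsf q!\{\lambda_i;G_i\}_{i\in I},\mathcal M)$ if $\mathrm{read}(G_i,\mathcal M)$ $\forall i\in I$; $\mathrm{read}(\mathsf p\mathsf q?\{\lambda_i;G_i\}_{i\in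 I},\langle\mathsf p,\lambda_h,\mathsf q\rangle\cdot\mathcal M)$ if $h\in I$ and $\mathrm{read}(G_i,\mathcal M)$ $\forall i\in I$; $\mathrm{read}(\mathsf p\mathsf q?\{\lambda_i;G_i\}_{i\in I},\mathcal M)$ if $\mathcal M\not\equiv\langle\mathsf p,\lambda_i,\mathsf q\rangle\cdot\mathcal M'$ for all $i\in I$ and all $\mathcal M'$, and $\mathrm{read}(G_i,\mathcal M)$ $\forall i\in I$. Deep readability $\mathcal S\vdash_{\mathrm{dread}}G:\mathcal M$ ($\mathcal S$ a finite set of global types) is defined inductively: $\mathcal S\vdash_{\mathrm{dread}}\mathsf{End}:\emptyset$; $\mathcal S\cup\{G\}\vdash_{\mathrm{dread}}G:\mathcal M$ if $\mathrm{read}(G,\mathcal M)$; for $G=\mathsf p\mathsf q\dagger\{\lambda_i;G_i\}_{i\in I}$ ($\dagger\in\{!,?\}$), $\mathcal S\vdash_{\mathrm{dread}}G:\mathcal M$ if $\mathcal S\cup\{G\}\vdash_{\mathrm{dread}}G_i:\mathcal M$ for all $i\in I$. $G$-equivalence: messages $\langle\mathsf p,\lambda,\mathsf q\rangle$ and $\langle\mathsf p,\lambda',\mathsf q\rangle$ are $G$-indistinguishable if $\lambda,\lambda'$ occur in $G$ and for every input choice $\mathsf p\mathsf q?\{\lambda_i;G_i\}_{i\in I}$ occurring in $G$, either $\{\lambda,\lambda'\}\cap\{\lambda_i\mid i\in I\}=\emptyset$, or $\lambda=\lambda_h$, $\lambda'=\lambda_k$ and $G_h=G_k$ for some $h,k\in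 I$. $\equiv_G$ is the equivalence on queues obtained by extending $\equiv$ with the clause $\mathcal M_1\cdot\langle\mathsf p,\lambda,\mathsf q\rangle\cdot\mathcal M_2\equiv_G\mathcal M_1\cdot\langle\mathsf p,\lambda',\mathsf q\rangle\cdot\mathcal M_2$ whenever these two messages are $G$-indistinguishable. -}

module Defs where

open import Data.Nat using (ℕ)
open import Data.Product using (Σ; ∃; ∃-syntax; _×_; _,_; proj₁; proj₂)
open import Data.Sum using (_⊎_)
open import Data.List using (List; []; _∷_; _++_; map)
open import Data.List.NonEmpty using (List⁺; toList)
open import Data.List.Relation.Unary.Any using (Any)
open import Data.List.Relation.Unary.All using (All)
open import Data.List.Relation.Unary.Unique.Propositional using (Unique)
open import Data.List.Membership.Propositional using (_∈_)
open import Relation.Binary.PropositionalEquality using (_≡_; _≢_)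
open import Relation.Nullary using (¬_)

Participant : Set
Participant = ℕ

Label : Set
Label = ℕ

-- Global types: possibly infinite terms (coinductive)
--   G ::= End | p q ! {λ_i ; G_i}_{i∈I} | p q ? {λ_i ; G_i}_{i∈I}

data Dir : Set where
  snd : Dir
  rcv : Dir

mutual
  record GT : Set where
    coinductive
    field node : Node

  data Node : Set where
    end : Node
    com : Dir → Participant → Participant → List⁺ (Label × GT) → Node

open GT public

Branch : Set
Branch = Label × GT

_∈ᵇ_ : Branch → List⁺ Branch → Set
b ∈ᵇ bs = b ∈ toList bs

labels : List⁺ Branch → List Label
labels bs = map proj₁ (toList bs)

-- Equality of (infinite) global types = bisimilarity
-- (branches are a finite map from labels, so order is irrelevant)

mutual
  record _≈ᵍ_ (G H : GT) : Set where
    coinductive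
    field bisim : NodeBisim (node G) (node H)

  data NodeBisim : Node → Node → Set where
    end : NodeBisim end end
    com : ∀ {d p q bs cs} →
          (∀ {l G} → (l , G) ∈ᵇ bs → ∃[ H ] ((l , H) ∈ᵇ cs × G ≈ᵍ H)) →
          (∀ {l H} → (l , H) ∈ᵇ cs → ∃[ G ] ((l , G) ∈ᵇ bs × G ≈ᵍ H)) →
          NodeBisim (com d p q bs) (com d p q cs)

open _≈ᵍ_ public

data Occ (H : GT) : GT → Set where
  here  : Occ H H
  there : ∀ {G d p q bs l G'} → node G ≡ com d p q bs → (l , G') ∈ᵇ bs →
          Occ H G' → Occ H G

WFNode : Node → Set
WFNode end = Data.Unit.⊤ where import Data.Unit
WFNode (com d p q bs) = p ≢ q × Unique (labels bs)

Regular : GT → Set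
Regular G = ∃[ L ] (∀ H → Occ H G → Any (H ≈ᵍ_) L)

IsGlobalType : GT → Set
IsGlobalType G = (∀ H → Occ H G → WFNode (node H)) × Regular G

record Msg : Set where
  constructor ⟨_,_,_⟩
  field sender : Participant
        label  : Label
        receiver : Participant

Queue : Set
Queue = List Msg

data _≈q_ : Queue → Queue → Set where
  q-refl  : ∀ {M} → M ≈q M
  q-sym   : ∀ {M M'} → M ≈q M' → M' ≈q M
  q-trans : ∀ {M M' M''} → M ≈q M' → M' ≈q M'' → M ≈q M''
  q-swap  : ∀ M₁ M₂ {p l q r l' s} → (p ≢ r ⊎ q ≢ s) →
            (M₁ ++ ⟨ p , l , q ⟩ ∷ ⟨ r , l' , s ⟩ ∷ M₂) ≈q
            (M₁ ++ ⟨ r , l' , s ⟩ ∷ ⟨ p , l , q ⟩ ∷ M₂)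

data Read : GT → Queue → Set where
  r-empty : ∀ {G} → Read G []
  r-out   : ∀ {G p q bs M} → node G ≡ com snd p q bs →
            (∀ {l G'} → (l , G') ∈ᵇ bs → Read G' M) → Read G M
  r-in    : ∀ {G p q bs M M' h Gh} → node G ≡ com rcv p q bs →
            (h , Gh) ∈ᵇ bs → M ≈q (⟨ p , h , q ⟩ ∷ M') →
            (∀ {l G'} → (l , G') ∈ᵇ bs → Read G' M') → Read G M
  r-skip  : ∀ {G p q bs M} → node G ≡ com rcv p q bs →
            (∀ {l G'} → (l , G') ∈ᵇ bs → ∀ M' → ¬ (M ≈q (⟨ p , l , q ⟩ ∷ M'))) →
            (∀ {l G'} → (l , G') ∈ᵇ bs → Read G' M) → Read G M

-- Deep readability S ⊢dread G : M   (S a finite set, given as a list;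
-- membership up to equality of global types)

data _⊢dread_∶_ : List GT → GT → Queue → Set where
  d-end  : ∀ {S G} → node G ≡ end → S ⊢dread G ∶ []
  d-read : ∀ {S G M} → Any (G ≈ᵍ_) S → Read G M → S ⊢dread G ∶ M
  d-step : ∀ {S G d p q bs M} → node G ≡ com d p q bs →
           (∀ {l G'} → (l , G') ∈ᵇ bs → (G ∷ S) ⊢dread G' ∶ M) →
           S ⊢dread G ∶ M

LabelOcc : Label → GT → Set
LabelOcc l G = ∃[ H ] ∃[ d ] ∃[ p ] ∃[ q ] ∃[ bs ]
  (Occ H G × node H ≡ com d p q bs × Any (λ b → proj₁ b ≡ l) (toList bs))

Indist : GT → Participant → Label → Label → Participant → Set
Indist G p l l' q =
  LabelOcc l G × LabelOcc l' G ×
  (∀ H bs → Occ H G → node H ≡ com rcv p q bs →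
     (¬ (l ∈ labels bs) × ¬ (l' ∈ labels bs))
     ⊎ (∃[ Gh ] ∃[ Gk ] ((l , Gh) ∈ᵇ bs × (l' , Gk) ∈ᵇ bs × Gh ≈ᵍ Gk)))

data _≈[_]_ : Queue → GT → Queue → Set where
  g-q     : ∀ {G M M'} → M ≈q M' → M ≈[ G ] M'
  g-sym   : ∀ {G M M'} → M ≈[ G ] M' → M' ≈[ G ] M
  g-trans : ∀ {G M M' M''} → M ≈[ G ] M' → M' ≈[ G ] M'' → M ≈[ G ] M''
  g-lab   : ∀ {G} M₁ M₂ {p l l' q} → Indist G p l l' q →
            (M₁ ++ ⟨ p , l , q ⟩ ∷ M₂) ≈[ G ] (M₁ ++ ⟨ p , l' , q ⟩ ∷ M₂)

{-# OPTIONS --safe #-}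
module Submission where

-- A swap in ≡ only inspects the endpoints of the two messages, which relabelling preserves,
-- so every ≡-rearrangement of a queue can be replayed on a pointwise relabelled copy.
-- G-indistinguishable labels are offered by exactly the same input choices of G, so a readability derivation replayed on the
-- relabelled queue reads, or skips, at exactly the same inputs.  Deep readability uses
-- readability only at its leaves, and its End leaves survive because ≡_G preserves length.

open import Defs
open import Data.Product using (_×_)
open import Data.List using (List)
open import Data.List.Relation.Unary.All using (All)

open import Data.Empty using (⊥-elim)
open import Data.Product using (∃-syntax; _,_; proj₁; proj₂)
open import Data.Sum as Sum using (_⊎_; inj₁; inj₂)
open import Data.List using ([]; _∷_; _++_; length)
open import Data.List.Properties using (length-++)
open import Data.List.Membership.Propositional using (_∈_)
open import Data.List.Membership.Propositional.Properties using (∈-map⁺; ∈-map⁻)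
open import Data.List.Relation.Binary.Pointwise as Pointwise using (Pointwise; []; _∷_; ++⁺)
open import Function.Bundles using (_⇔_; mk⇔; Equivalence)
open import Function.Construct.Identity using (⇔-id)
open import Function.Construct.Symmetry using (⇔-sym)
open import Function.Construct.Composition using (_⇔-∘_)
open import Relation.Nullary using (¬_)
open import Relation.Binary.PropositionalEquality using (_≡_; _≢_; refl; sym; trans; ≢-sym)

Occ-trans : ∀ {A B C} → Occ A B → Occ B C → Occ A C
Occ-trans o here = o
Occ-trans o (there e m o') = there e m (Occ-trans o o')

Occ-child : ∀ {G Y d p q bs l Y'} → Occ Y G → node Y ≡ com d p q bs → (l , Y') ∈ᵇ bs → Occ Y' G
Occ-child oY e m = Occ-trans (there e m here) oY

≈q-length : ∀ {M M'} → M ≈q M' → length M ≡ length M'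
≈q-length q-refl = refl
≈q-length (q-sym d) = sym (≈q-length d)
≈q-length (q-trans d e) = trans (≈q-length d) (≈q-length e)
≈q-length (q-swap M₁ M₂ _) = trans (length-++ M₁) (sym (length-++ M₁))

≈[]-length : ∀ {G M M'} → M ≈[ G ] M' → length M ≡ length M'
≈[]-length (g-q d) = ≈q-length d
≈[]-length (g-sym d) = sym (≈[]-length d)
≈[]-length (g-trans d e) = trans (≈[]-length d) (≈[]-length e)
≈[]-length (g-lab M₁ M₂ _) = trans (length-++ M₁) (sym (length-++ M₁))

length-0⇒[] : ∀ {M : Queue} → 0 ≡ length M → M ≡ []
length-0⇒[] {[]} _ = refl

≈q-[] : ∀ {M} → [] ≈q M → M ≡ []
≈q-[] d = length-0⇒[] (≈q-length d)

≈[]-[] : ∀ {G M} → [] ≈[ G ] M → M ≡ []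
≈[]-[] d = length-0⇒[] (≈[]-length d)

Read-resp-≈q : ∀ {X M M'} → M ≈q M' → Read X M → Read X M'
Read-resp-≈q d r-empty with refl ← ≈q-[] d = r-empty
Read-resp-≈q d (r-out e f) = r-out e (λ m → Read-resp-≈q d (f m))
Read-resp-≈q d (r-in e m d' f) = r-in e m (q-trans (q-sym d) d') f
Read-resp-≈q d (r-skip e ns f) =
  r-skip e (λ m M' d' → ns m M' (q-trans d d')) (λ m → Read-resp-≈q d (f m))

LabelRel : Set₁
LabelRel = Participant → Label → Label → Participant → Set

data Relabel (R : LabelRel) : Msg → Msg → Set where
  relabel : ∀ {p l l' q} → R p l l' q → Relabel R ⟨ p , l , q ⟩ ⟨ p , l' , q ⟩

Relabelling : LabelRel → Queue → Queue → Set
Relabelling R = Pointwise (Relabel R)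

Relabel-sym : ∀ {R : LabelRel} → (∀ {p l l' q} → R p l l' q → R p l' l q) →
              ∀ {m m'} → Relabel R m m' → Relabel R m' m
Relabel-sym R-sym (relabel x) = relabel (R-sym x)

Pointwise-++⁻ : ∀ {A B : Set} {R : A → B → Set} (xs : List A) {ys zs} →
                Pointwise R (xs ++ ys) zs →
                ∃[ zs₁ ] ∃[ zs₂ ] (zs ≡ zs₁ ++ zs₂ × Pointwise R xs zs₁ × Pointwise R ys zs₂)
Pointwise-++⁻ [] rs = [] , _ , refl , [] , rs
Pointwise-++⁻ (x ∷ xs) (r ∷ rs) with Pointwise-++⁻ xs rs
... | zs₁ , zs₂ , refl , rs₁ , rs₂ = _ ∷ zs₁ , zs₂ , refl , r ∷ rs₁ , rs₂

module _ {R : LabelRel} where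

  Relabelling-swap : ∀ M₁ {M₂ p l q r l' s Z} → p ≢ r ⊎ q ≢ s →
    Relabelling R (M₁ ++ ⟨ p , l , q ⟩ ∷ ⟨ r , l' , s ⟩ ∷ M₂) Z →
    ∃[ Z' ] (Z ≈q Z' × Relabelling R (M₁ ++ ⟨ r , l' , s ⟩ ∷ ⟨ p , l , q ⟩ ∷ M₂) Z')
  Relabelling-swap M₁ c rs with Pointwise-++⁻ M₁ rs
  ... | Z₁ , _ , refl , rs₁ , relabel x ∷ relabel y ∷ rs₂ =
    _ , q-swap Z₁ _ c , ++⁺ rs₁ (relabel y ∷ relabel x ∷ rs₂)

  mutual
    ≈q-relabelˡ : ∀ {M A M'} → M ≈q A → Relabelling R M M' →
                  ∃[ A' ] (M' ≈q A' × Relabelling R A A')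
    ≈q-relabelˡ q-refl rs = _ , q-refl , rs
    ≈q-relabelˡ (q-sym d) rs with ≈q-relabelʳ d rs
    ... | A' , d' , rs' = A' , q-sym d' , rs'
    ≈q-relabelˡ (q-trans d e) rs with ≈q-relabelˡ d rs
    ... | _ , d' , rs' with ≈q-relabelˡ e rs'
    ... | A' , e' , rs'' = A' , q-trans d' e' , rs''
    ≈q-relabelˡ (q-swap M₁ M₂ c) rs = Relabelling-swap M₁ c rs

    ≈q-relabelʳ : ∀ {M A A'} → M ≈q A → Relabelling R A A' →
                  ∃[ M' ] (M' ≈q A' × Relabelling R M M')
    ≈q-relabelʳ q-refl rs = _ , q-refl , rs
    ≈q-relabelʳ (q-sym d) rs with ≈q-relabelˡ d rs
    ... | M' , d' , rs' = M' , q-sym d' , rs'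
    ≈q-relabelʳ (q-trans d e) rs with ≈q-relabelʳ e rs
    ... | _ , e' , rs' with ≈q-relabelʳ d rs'
    ... | M' , d' , rs'' = M' , q-trans d' e' , rs''
    ≈q-relabelʳ (q-swap M₁ M₂ c) rs with Relabelling-swap M₁ (Sum.map ≢-sym ≢-sym c) rs
    ... | M' , d , rs' = M' , q-sym d , rs'

InputEquivalent : GT → LabelRel
InputEquivalent G p l l' q =
  ∀ Y bs → Occ Y G → node Y ≡ com rcv p q bs → l ∈ labels bs ⇔ l' ∈ labels bs

InputEquivalent-refl : ∀ {G p l q} → InputEquivalent G p l l q
InputEquivalent-refl _ _ _ _ = ⇔-id _

InputEquivalent-sym : ∀ {G p l l' q} → InputEquivalent G p l l' q → InputEquivalent G p l' l q
InputEquivalent-sym eqv Y bs oY e = ⇔-sym (eqv Y bs oY e)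

Indist⇒InputEquivalent : ∀ {G p l l' q} → Indist G p l l' q → InputEquivalent G p l l' q
Indist⇒InputEquivalent (_ , _ , choices) Y bs oY e with choices Y bs oY e
... | inj₁ (l∉ , l'∉) = mk⇔ (λ l∈ → ⊥-elim (l∉ l∈)) (λ l'∈ → ⊥-elim (l'∉ l'∈))
... | inj₂ (_ , _ , mh , mk , _) = mk⇔ (λ _ → ∈-map⁺ proj₁ mk) (λ _ → ∈-map⁺ proj₁ mh)

InputEquivalent-branch : ∀ {G Y p q bs l l' Gl} → InputEquivalent G p l l' q →
  Occ Y G → node Y ≡ com rcv p q bs → (l , Gl) ∈ᵇ bs → ∃[ Gl' ] ((l' , Gl') ∈ᵇ bs)
InputEquivalent-branch eqv oY e m
  with ∈-map⁻ proj₁ (Equivalence.to (eqv _ _ oY e) (∈-map⁺ proj₁ m))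
... | (_ , Gl') , m' , refl = Gl' , m'

Relabelling-refl : ∀ {G} M → Relabelling (InputEquivalent G) M M
Relabelling-refl M = Pointwise.refl (relabel InputEquivalent-refl) {M}

Relabelling-sym : ∀ {G N N'} → Relabelling (InputEquivalent G) N N' →
                  Relabelling (InputEquivalent G) N' N
Relabelling-sym = Pointwise.symmetric (Relabel-sym InputEquivalent-sym)

Read-relabel : ∀ {G X N N'} → Occ X G → Relabelling (InputEquivalent G) N N' →
               Read X N → Read X N'
Read-relabel oX [] r-empty = r-empty
Read-relabel oX rs (r-out e f) = r-out e (λ m → Read-relabel (Occ-child oX e m) rs (f m))
Read-relabel oX rs (r-in e m d f) with ≈q-relabelˡ d rs
... | _ , d' , relabel eqv ∷ rs' =
  r-in e (proj₂ (InputEquivalent-branch eqv oX e m)) d'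
       (λ m' → Read-relabel (Occ-child oX e m') rs' (f m'))
Read-relabel {N' = N'} oX rs (r-skip {p = p} {q} {bs} e ns f) =
  r-skip e absent (λ m → Read-relabel (Occ-child oX e m) rs (f m))
  where
    absent : ∀ {l Gl} → (l , Gl) ∈ᵇ bs → ∀ M' → ¬ (N' ≈q (⟨ p , l , q ⟩ ∷ M'))
    absent m M' d with ≈q-relabelˡ d (Relabelling-sym rs)
    ... | _ , d' , relabel eqv ∷ _ = ns (proj₂ (InputEquivalent-branch eqv oX e m)) _ d'

Read-resp-≈[] : ∀ {G X M M'} → Occ X G → M ≈[ G ] M' → Read X M ⇔ Read X M'
Read-resp-≈[] oX (g-q d) = mk⇔ (Read-resp-≈q d) (Read-resp-≈q (q-sym d))
Read-resp-≈[] oX (g-sym d) = ⇔-sym (Read-resp-≈[] oX d)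
Read-resp-≈[] oX (g-trans d e) = Read-resp-≈[] oX e ⇔-∘ Read-resp-≈[] oX d
Read-resp-≈[] oX (g-lab M₁ M₂ ind) =
  mk⇔ (Read-relabel oX rs) (Read-relabel oX (Relabelling-sym rs))
  where
    rs : Relabelling (InputEquivalent _) (M₁ ++ _ ∷ M₂) (M₁ ++ _ ∷ M₂)
    rs = ++⁺ (Relabelling-refl M₁) (relabel (Indist⇒InputEquivalent ind) ∷ Relabelling-refl M₂)

dread-resp-≈[] : ∀ {G S X M M'} → Occ X G → M ≈[ G ] M' → S ⊢dread X ∶ M → S ⊢dread X ∶ M'
dread-resp-≈[] oX d (d-end e) with refl ← ≈[]-[] d = d-end e
dread-resp-≈[] oX d (d-read a r) = d-read a (Equivalence.to (Read-resp-≈[] oX d) r)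
dread-resp-≈[] oX d (d-step e f) = d-step e (λ m → dread-resp-≈[] (Occ-child oX e m) d (f m))

proposition6p4 : ∀ (G : GT) (M M' : Queue) → IsGlobalType G → M ≈[ G ] M' →
    (Read G M → Read G M')
    × (∀ (S : List GT) → All IsGlobalType S → S ⊢dread G ∶ M → S ⊢dread G ∶ M')
proposition6p4 G M M' _ d =
  Equivalence.to (Read-resp-≈[] here d) , λ S _ → dread-resp-≈[] here d
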